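{- In the binary tree instance described in the context, for any internal node $u$ let $L_u$ (resp. $R_u$) be the subtree rooted at the left (resp. right) child of $u$. Then for every node $v\in L_u$, $d(\rho,v)>B-2s_u$, and for every node $v\in R_u$, $d(\rho,v)\le B-4s_u$, where $d(\rho,v)$ is the sum of edge lengths on the tree path from $\rho$ to $v$.
   Context: Let $L\ge 2$ be an integer and $B:=2^{2^{L+1}}$. Let $\mathcal{T}$ be a complete binary tree with root $\rho$ in which every root-to-leaf path has $L$ nodes; each internal node has a left and a right child. The level $\ell(v)$ of a node is the number of nodes on the path from $v$ to a leaf (leaves have level 1, the root level $L$). Sizes: $s_\rho:=2^{2^L}$, and for a node $v$ with parent $u$, $s_v:=s_u\cdot 2^{2^{\ell(v)}}$ if $v$ is the right child and $s_v:=s_u\cdot 2^{ -2^{\ell(v)}}$ if $v$ is the left child. Residual budgets: $b(\rho):=B$, and $b(v):=b(u)-s_u$ if $v$ is the right child of $u$, $b(v):=s_u$ if $v$ is the left child. Edge lengths: the edge from $u$ to its right child has length $0$, and the edge from $u$ to its left child has length $b(u)-s_u$. -}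

module Defs where

open import Data.Nat using (ℕ; zero; suc; _∸_)
open import Data.Integer using (+_)
open import Data.Rational using (ℚ; _/_; _*_; _+_; _-_; ½; 0ℚ)
open import Data.Bool using (Bool; true; false)
open import Data.List using (List; []; _∷_)
open import Data.Product using (_×_; _,_; proj₁; proj₂)

_^ℚ_ : ℚ → ℕ → ℚ
q ^ℚ zero  = + 1 / 1
q ^ℚ suc k = q * (q ^ℚ k)

two : ℚ
two = + 2 / 1

tower : ℕ → ℚ
tower k = two ^ℚ (2 ^ℕ k)
  where
  _^ℕ_ : ℕ → ℕ → ℕ
  _^ℕ_ = Data.Nat._^_
  open import Data.Nat

invTower : ℕ → ℚ
invTower k = ½ ^ℚ (Data.Nat._^_ 2 k)
  where open import Data.Nat

-- Nodes of the tree are addressed by their path from the root: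
-- a list of directions, true = right child, false = left child.
-- A path p is a node of the tree of depth L iff length p < L; the node
-- at path p has level L ∸ length p.

-- walk ℓ (s , b , d) p : starting at a node of level ℓ with size s,
-- residual budget b and root-distance d, follow path p and return
-- (size, residual budget, root-distance) of the node reached.
walk : ℕ → ℚ × ℚ × ℚ → List Bool → ℚ × ℚ × ℚ
walk ℓ sbd [] = sbd
walk ℓ (s , b , d) (true ∷ p) =
  -- right child v of level ℓ ∸ 1: s_v = s_u 2^{2^{ℓ(v)}}, b(v) = b(u) - s_u, edge length 0
  walk (ℓ ∸ 1) (s * tower (ℓ ∸ 1) , b - s , d + 0ℚ) p
walk ℓ (s , b , d) (false ∷ p) =
  -- left child v: s_v = s_u 2^{-2^{ℓ(v)}}, b(v) = s_u, edge length b(u) - s_u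
  walk (ℓ ∸ 1) (s * invTower (ℓ ∸ 1) , s , d + (b - s)) p

budgetB : ℕ → ℚ
budgetB L = tower (suc L)

nodeData : ℕ → List Bool → ℚ × ℚ × ℚ
nodeData L p = walk L (tower L , budgetB L , 0ℚ) p

size : ℕ → List Bool → ℚ
size L p = proj₁ (nodeData L p)

resBudget : ℕ → List Bool → ℚ
resBudget L p = proj₁ (proj₂ (nodeData L p))

dist : ℕ → List Bool → ℚ
dist L p = proj₂ (proj₂ (nodeData L p))

module Submission where

-- From a node (size s, residual budget b, root distance d) of level m + 1, with
-- t = 2^(2^m), the right child is (s t, b - s, d) and the left child is
-- (s / t, s, d + b - s).  Two invariants are preserved by both child steps:
-- * Balanced, at ratio T = t² and slack r = B - (d + b):
--   0 < s, s T ≤ b + s, 0 ≤ r and r T ≤ 2 s.  It holds at the root; at an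
--   internal node u it gives r < s, so the left child of u, at distance
--   B - r - s, is farther than B - 2 s_u, and distances never decrease.
-- * Capped σ:  σ T ≤ s, d + b ≤ B - σ and d ≤ B - 4 σ.  It holds for σ = s_u
--   at the right child of u (as b ≥ 4 s_u there) and bounds its whole subtree.

open import Data.Nat as ℕ using (ℕ; zero; suc; _∸_; s≤s)
import Data.Nat.Properties as ℕ
open import Data.Rational using (ℚ; 0ℚ; 1ℚ; ½; _/_; -_; _+_; _-_; _*_; _≤_; _<_; _≤?_; _<?_; nonNegative; positive)
open import Data.Rational.Properties
open import Data.Integer using (+_)
open import Data.Bool using (Bool; true; false)
open import Data.List using (List; []; _∷_; _++_; length)
open import Data.Product using (_×_; _,_; proj₁; proj₂)
open import Data.Unit using (tt)
open import Level using (0ℓ)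
open import Relation.Binary.PropositionalEquality
open import Relation.Nullary.Decidable using (toWitness; dec⇒maybe)
import Tactic.RingSolver as RingSolver
open import Tactic.RingSolver.Core.AlmostCommutativeRing using (AlmostCommutativeRing; fromCommutativeRing)

open import Algebra.Bundles using (CommutativeMonoid)
open import Algebra.Properties.CommutativeSemigroup
  (CommutativeMonoid.commutativeSemigroup *-1-commutativeMonoid)
  using () renaming (interchange to *-interchange)

open import Defs

ℚ-ring : AlmostCommutativeRing 0ℓ 0ℓ
ℚ-ring = fromCommutativeRing +-*-commutativeRing (λ x → dec⇒maybe (0ℚ ≟ x))

open RingSolver using (solve)

four five : ℚ
four = + 4 / 1
five = + 5 / 1

0<2 : 0ℚ < two
0<2 = toWitness {a? = 0ℚ <? two} tt

0<½ : 0ℚ < ½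
0<½ = toWitness {a? = 0ℚ <? ½} tt

0≤+ : ∀ {x y} → 0ℚ ≤ x → 0ℚ ≤ y → 0ℚ ≤ x + y
0≤+ = +-mono-≤

0≤* : ∀ {x y} → 0ℚ ≤ x → 0ℚ ≤ y → 0ℚ ≤ x * y
0≤* {x} {y} hx hy = subst (_≤ x * y) (*-zeroʳ x) (*-monoˡ-≤-nonNeg x {{nonNegative hx}} hy)

0<* : ∀ {x y} → 0ℚ < x → 0ℚ < y → 0ℚ < x * y
0<* {x} {y} hx hy = subst (_< x * y) (*-zeroʳ x) (*-monoʳ-<-pos x {{positive hx}} hy)

0≤-difference : ∀ {x y} → x ≤ y → 0ℚ ≤ y - x
0≤-difference {x} {y} h = subst (_≤ y - x) (+-inverseʳ x) (+-monoˡ-≤ (- x) h)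

0<-difference : ∀ {x y} → x < y → 0ℚ < y - x
0<-difference {x} {y} h = subst (_< y - x) (+-inverseʳ x) (+-monoˡ-< (- x) h)

≤-by : ∀ {a b} z → 0ℚ ≤ z → b ≡ a + z → a ≤ b
≤-by {a} z hz eq = subst (a ≤_) (sym eq) (subst (_≤ a + z) (+-identityʳ a) (+-monoʳ-≤ a hz))

<-by : ∀ {a b} z → 0ℚ < z → b ≡ a + z → a < b
<-by {a} z hz eq = subst (a <_) (sym eq) (subst (_< a + z) (+-identityʳ a) (+-monoʳ-< a hz))

*-monoʳ : ∀ {x y} c → 0ℚ ≤ c → x ≤ y → x * c ≤ y * c
*-monoʳ c hc = *-monoʳ-≤-nonNeg c {{nonNegative hc}}

*-monoˡ : ∀ {x y} c → 0ℚ ≤ c → x ≤ y → c * x ≤ c * y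
*-monoˡ c hc = *-monoˡ-≤-nonNeg c {{nonNegative hc}}

square-mono : ∀ {a t} → 0ℚ ≤ a → a ≤ t → a * a ≤ t * t
square-mono {a} {t} ha h = ≤-trans (*-monoˡ a ha h) (*-monoʳ t (≤-trans ha h) h)

square≥4 : ∀ {t} → two ≤ t → four ≤ t * t
square≥4 = square-mono (<⇒≤ 0<2)

≤-*-grow : ∀ {x c} → 0ℚ ≤ x → 1ℚ ≤ c → x ≤ x * c
≤-*-grow {x} {c} x≥0 c≥1 = ≤-by (x * (c - 1ℚ)) (0≤* x≥0 (0≤-difference c≥1))
                                 (solve (x ∷ c ∷ []) ℚ-ring)

cancel-inverse : ∀ {i t} → i * t ≡ 1ℚ → ∀ x → (x * i) * t ≡ x
cancel-inverse {i} {t} it≡1 x = begin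
  (x * i) * t ≡⟨ *-assoc x i t ⟩
  x * (i * t) ≡⟨ cong (x *_) it≡1 ⟩
  x * 1ℚ      ≡⟨ *-identityʳ x ⟩
  x           ∎
  where open ≡-Reasoning

rescale-inverse : ∀ {i t} → i * t ≡ 1ℚ → ∀ x → x * t ≡ (x * (t * t)) * i
rescale-inverse {i} {t} it≡1 x = begin
  x * t               ≡⟨ cancel-inverse it≡1 (x * t) ⟨
  ((x * t) * i) * t   ≡⟨ solve (x ∷ t ∷ i ∷ []) ℚ-ring ⟩
  (x * (t * t)) * i   ∎
  where open ≡-Reasoning

^-+ : ∀ q m n → q ^ℚ (m ℕ.+ n) ≡ q ^ℚ m * q ^ℚ n
^-+ q zero    n = sym (*-identityˡ (q ^ℚ n))
^-+ q (suc m) n = trans (cong (q *_) (^-+ q m n)) (sym (*-assoc q (q ^ℚ m) (q ^ℚ n)))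

^-positive : ∀ {q} n → 0ℚ < q → 0ℚ < q ^ℚ n
^-positive zero    _  = toWitness {a? = 0ℚ <? 1ℚ} tt
^-positive (suc n) hq = 0<* hq (^-positive n hq)

^-inverse : ∀ {p q} → p * q ≡ 1ℚ → ∀ n → p ^ℚ n * q ^ℚ n ≡ 1ℚ
^-inverse pq≡1 zero    = refl
^-inverse {p} {q} pq≡1 (suc n) = begin
  (p * x) * (q * y) ≡⟨ *-interchange p x q y ⟩
  (p * q) * (x * y) ≡⟨ cong₂ _*_ pq≡1 (^-inverse pq≡1 n) ⟩
  1ℚ * 1ℚ           ≡⟨ *-identityˡ 1ℚ ⟩
  1ℚ                ∎
  where
  open ≡-Reasoning
  x = p ^ℚ n
  y = q ^ℚ n

tower-square : ∀ k → tower (suc k) ≡ tower k * tower k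
tower-square k = trans (cong (λ e → two ^ℚ (2 ℕ.^ k ℕ.+ e)) (ℕ.+-identityʳ (2 ℕ.^ k)))
                       (^-+ two (2 ℕ.^ k) (2 ℕ.^ k))

tower-positive : ∀ k → 0ℚ < tower k
tower-positive k = ^-positive (2 ℕ.^ k) 0<2

invTower-positive : ∀ k → 0ℚ < invTower k
invTower-positive k = ^-positive (2 ℕ.^ k) (0<½)

invTower-inverse : ∀ k → invTower k * tower k ≡ 1ℚ
invTower-inverse k = ^-inverse refl (2 ℕ.^ k)

tower≥2 : ∀ k → two ≤ tower k
tower≥2 zero    = ≤-refl
tower≥2 (suc k) = subst (two ≤_) (sym (tower-square k))
  (≤-trans (toWitness {a? = two ≤? two * two} tt)
           (square-mono (<⇒≤ 0<2) (tower≥2 k)))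

tower≥4 : ∀ k → four ≤ tower (suc k)
tower≥4 k = subst (four ≤_) (sym (tower-square k)) (square≥4 (tower≥2 k))

tower≥5 : ∀ k → five ≤ tower (suc (suc k))
tower≥5 k = subst (five ≤_) (sym (tower-square (suc k)))
  (≤-trans (toWitness {a? = five ≤? four * four} tt)
           (square-mono (toWitness {a? = 0ℚ ≤? four} tt) (tower≥4 k)))

-- The slack B - (d + b) is
-- the total size paid for the right steps on the path to the node.
record Balanced (B T s b d : ℚ) : Set where
  field
    size-positive : 0ℚ < s
    budget-large  : s * T ≤ b + s
    within-budget : d + b ≤ B
    slack-small   : (B - (d + b)) * T ≤ two * s

root-balanced : ∀ {t} → 0ℚ < t → Balanced (t * t) t t (t * t) 0ℚ
root-balanced {t} t>0 = record
  { size-positive = t>0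
  ; budget-large  = ≤-by t (<⇒≤ t>0) refl
  ; within-budget = ≤-reflexive (+-identityˡ (t * t))
  ; slack-small   = ≤-by (two * t) (0≤* (<⇒≤ 0<2) (<⇒≤ t>0))
                         (solve (t ∷ []) ℚ-ring)
  }

module _ {B T s b d : ℚ} (bal : Balanced B T s b d) where
  open Balanced bal

  -- With T ≥ 2 the budget covers the size, so a left step does not go back up.
  size≤budget : two ≤ T → s ≤ b
  size≤budget T≥2 = ≤-by (b + s - s * T + s * (T - two))
    (0≤+ (0≤-difference budget-large) (0≤* (<⇒≤ size-positive) (0≤-difference T≥2)))
    (solve (b ∷ s ∷ T ∷ []) ℚ-ring)

  -- With T ≥ 4 the slack r is below the size: 4 r ≤ r T ≤ 2 s.
  slack<size : four ≤ T → B - (d + b) < s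
  slack<size T≥4 =
    <-by (½ * ½ * (two * s - (B - (d + b)) * T) + ½ * ½ * ((B - (d + b)) * (T - four)) + ½ * s)
      (+-mono-≤-< (0≤+ (0≤* ¼≥0 (0≤-difference slack-small))
                       (0≤* ¼≥0 (0≤* (0≤-difference within-budget) (0≤-difference T≥4))))
                  (0<* (0<½) size-positive))
      (solve (s ∷ B ∷ d ∷ b ∷ T ∷ []) ℚ-ring)
    where
    ¼≥0 : 0ℚ ≤ ½ * ½
    ¼≥0 = toWitness {a? = 0ℚ ≤? ½ * ½} tt

-- A right step (ratio t² to t, size s t, budget b - s, same distance)
-- preserves balance: the slack grows by s, which stays below 2 s.
balanced-right : ∀ {B s b d t} → two ≤ t → Balanced B (t * t) s b d →
                 Balanced B t (s * t) (b - s) (d + 0ℚ)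
balanced-right {B} {s} {b} {d} {t} t≥2 bal = record
  { size-positive = 0<* size-positive t>0
  ; budget-large  = ≤-by (b + s - s * (t * t) + s * (t - two))
      (0≤+ (0≤-difference budget-large) (0≤* (<⇒≤ size-positive) (0≤-difference t≥2)))
      (solve (b ∷ s ∷ t ∷ []) ℚ-ring)
  ; within-budget = ≤-by (B - (d + b) + s)
      (0≤+ (0≤-difference within-budget) (<⇒≤ size-positive))
      (solve (B ∷ d ∷ b ∷ s ∷ []) ℚ-ring)
  ; slack-small   = begin
      (B - (d + 0ℚ + (b - s))) * t ≡⟨ solve (B ∷ d ∷ b ∷ s ∷ t ∷ []) ℚ-ring ⟩
      (B - (d + b) + s) * t        ≤⟨ *-monoʳ t (<⇒≤ t>0) (+-monoˡ-≤ s slack≤size) ⟩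
      (s + s) * t                  ≡⟨ solve (s ∷ t ∷ []) ℚ-ring ⟩
      two * (s * t)                ∎
  }
  where
  open Balanced bal
  open ≤-Reasoning
  t>0 : 0ℚ < t
  t>0 = <-≤-trans 0<2 t≥2
  slack≤size : B - (d + b) ≤ s
  slack≤size = <⇒≤ (slack<size bal (square≥4 t≥2))

-- A left step (ratio t² to t, size s i with i t = 1, budget s, distance
-- d + b - s) preserves balance: the slack is unchanged, and r t = r t² i.
balanced-left : ∀ {B s b d t i} → 0ℚ < i → i * t ≡ 1ℚ → Balanced B (t * t) s b d →
                Balanced B t (s * i) s (d + (b - s))
balanced-left {B} {s} {b} {d} {t} {i} i>0 it≡1 bal = record
  { size-positive = 0<* size-positive i>0
  ; budget-large  = begin
      (s * i) * t ≡⟨ cancel-inverse it≡1 s ⟩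
      s           ≤⟨ ≤-by (s * i) (0≤* (<⇒≤ size-positive) (<⇒≤ i>0)) refl ⟩
      s + s * i   ∎
  ; within-budget = begin
      d + (b - s) + s ≡⟨ solve (d ∷ b ∷ s ∷ []) ℚ-ring ⟩
      d + b           ≤⟨ within-budget ⟩
      B               ∎
  ; slack-small   = begin
      (B - (d + (b - s) + s)) * t   ≡⟨ cong (λ x → (B - x) * t) (solve (d ∷ b ∷ s ∷ []) ℚ-ring) ⟩
      (B - (d + b)) * t             ≡⟨ rescale-inverse it≡1 (B - (d + b)) ⟩
      (B - (d + b)) * (t * t) * i   ≤⟨ *-monoʳ i (<⇒≤ i>0) slack-small ⟩
      two * s * i                   ≡⟨ *-assoc two s i ⟩
      two * (s * i)                 ∎
  }
  where
  open Balanced bal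
  open ≤-Reasoning

record Capped (B σ T s b d : ℚ) : Set where
  field
    size-large    : σ * T ≤ s
    within-budget : d + b ≤ B - σ
    distance-far  : d ≤ B - four * σ

capped-right-child : ∀ {B s b d t} → five ≤ t * t → Balanced B (t * t) s b d →
                     Capped B s t (s * t) (b - s) (d + 0ℚ)
capped-right-child {B} {s} {b} {d} {t} T≥5 bal = record
  { size-large    = ≤-refl
  ; within-budget = ≤-by (B - (d + b)) (0≤-difference within-budget)
                         (solve (B ∷ d ∷ b ∷ s ∷ []) ℚ-ring)
  ; distance-far  = ≤-by (B - (d + b) + (b + s - s * (t * t)) + s * (t * t - five))
      (0≤+ (0≤+ (0≤-difference within-budget) (0≤-difference budget-large))
           (0≤* (<⇒≤ size-positive) (0≤-difference T≥5)))
      (solve (B ∷ d ∷ b ∷ s ∷ t ∷ []) ℚ-ring)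
  }
  where open Balanced bal

module _ {B σ : ℚ} (σ≥0 : 0ℚ ≤ σ) where

  capped-right : ∀ {s b d t} → two ≤ t → Capped B σ (t * t) s b d →
                 Capped B σ t (s * t) (b - s) (d + 0ℚ)
  capped-right {s} {b} {d} {t} t≥2 cap = record
    { size-large    = *-monoʳ t t≥0 σ≤s
    ; within-budget = ≤-by (B - σ - (d + b) + s)
        (0≤+ (0≤-difference within-budget) (≤-trans σ≥0 σ≤s))
        (solve (B ∷ σ ∷ d ∷ b ∷ s ∷ []) ℚ-ring)
    ; distance-far  = ≤-trans (≤-reflexive (+-identityʳ d)) distance-far
    }
    where
    open Capped cap
    t≥0 : 0ℚ ≤ t
    t≥0 = ≤-trans (<⇒≤ 0<2) t≥2
    σ≤s : σ ≤ s
    σ≤s = ≤-trans (≤-*-grow σ≥0 (≤-trans (toWitness {a? = 1ℚ ≤? four} tt) (square≥4 t≥2)))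
                  size-large

  -- A left step keeps the node capped: it spends s ≥ 4 σ of the remaining
  -- budget, and this is what pays for the bound on the distance.
  capped-left : ∀ {s b d t i} → two ≤ t → 0ℚ < i → i * t ≡ 1ℚ → Capped B σ (t * t) s b d →
                Capped B σ t (s * i) s (d + (b - s))
  capped-left {s} {b} {d} {t} {i} t≥2 i>0 it≡1 cap = record
    { size-large    = begin
        σ * t             ≡⟨ rescale-inverse it≡1 σ ⟩
        σ * (t * t) * i   ≤⟨ *-monoʳ i (<⇒≤ i>0) size-large ⟩
        s * i             ∎
    ; within-budget = begin
        d + (b - s) + s ≡⟨ solve (d ∷ b ∷ s ∷ []) ℚ-ring ⟩
        d + b           ≤⟨ within-budget ⟩
        B - σ           ∎
    ; distance-far  = ≤-by (B - σ - (d + b) + (s - σ * (t * t)) + σ * (t * t - four) + σ)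
        (0≤+ (0≤+ (0≤+ (0≤-difference within-budget) (0≤-difference size-large))
                  (0≤* σ≥0 (0≤-difference (square≥4 t≥2))))
             σ≥0)
        (solve (B ∷ σ ∷ d ∷ b ∷ s ∷ t ∷ []) ℚ-ring)
    }
    where
    open Capped cap
    open ≤-Reasoning

rightChild leftChild : ℕ → ℚ × ℚ × ℚ → ℚ × ℚ × ℚ
rightChild m (s , b , d) = (s * tower m , b - s , d + 0ℚ)
leftChild  m (s , b , d) = (s * invTower m , s , d + (b - s))

distance : ℚ × ℚ × ℚ → ℚ
distance (_ , _ , d) = d

relevel : ∀ ℓ (p q : List Bool) y → walk (ℓ ∸ 1 ∸ length p) y q ≡ walk (ℓ ∸ suc (length p)) y q
relevel ℓ p q y = cong (λ k → walk k y q) (ℕ.∸-+-assoc ℓ 1 (length p))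

walk-++ : ∀ ℓ x p q → walk ℓ x (p ++ q) ≡ walk (ℓ ∸ length p) (walk ℓ x p) q
walk-++ ℓ x []          q = refl
walk-++ ℓ x (true ∷ p)  q = trans (walk-++ (ℓ ∸ 1) y p q) (relevel ℓ p q (walk (ℓ ∸ 1) y p))
  where y = rightChild (ℓ ∸ 1) x
walk-++ ℓ x (false ∷ p) q = trans (walk-++ (ℓ ∸ 1) y p q) (relevel ℓ p q (walk (ℓ ∸ 1) y p))
  where y = leftChild (ℓ ∸ 1) x

walk-invariant : (P : ℕ → ℚ × ℚ × ℚ → Set) →
                 (∀ m x → P (suc m) x → P m (rightChild m x)) →
                 (∀ m x → P (suc m) x → P m (leftChild m x)) →
                 ∀ ℓ x p → length p ℕ.≤ ℓ → P ℓ x → P (ℓ ∸ length p) (walk ℓ x p)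
walk-invariant P right left ℓ       x []          _         px = px
walk-invariant P right left (suc m) x (true ∷ p)  (s≤s |p|≤m) px =
  walk-invariant P right left m (rightChild m x) p |p|≤m (right m x px)
walk-invariant P right left (suc m) x (false ∷ p) (s≤s |p|≤m) px =
  walk-invariant P right left m (leftChild m x) p |p|≤m (left m x px)

BalancedAt : ℚ → ℕ → ℚ × ℚ × ℚ → Set
BalancedAt B ℓ (s , b , d) = Balanced B (tower ℓ) s b d

CappedAt : ℚ → ℚ → ℕ → ℚ × ℚ × ℚ → Set
CappedAt B σ ℓ (s , b , d) = Capped B σ (tower ℓ) s b d

balancedAt-right : ∀ B m x → BalancedAt B (suc m) x → BalancedAt B m (rightChild m x)
balancedAt-right B m (s , b , d) bal =
  balanced-right (tower≥2 m) (subst (λ T → Balanced B T s b d) (tower-square m) bal)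

balancedAt-left : ∀ B m x → BalancedAt B (suc m) x → BalancedAt B m (leftChild m x)
balancedAt-left B m (s , b , d) bal =
  balanced-left (invTower-positive m) (invTower-inverse m)
                (subst (λ T → Balanced B T s b d) (tower-square m) bal)

cappedAt-right : ∀ {B σ} → 0ℚ ≤ σ → ∀ m x → CappedAt B σ (suc m) x → CappedAt B σ m (rightChild m x)
cappedAt-right {B} {σ} σ≥0 m (s , b , d) cap =
  capped-right σ≥0 (tower≥2 m) (subst (λ T → Capped B σ T s b d) (tower-square m) cap)

cappedAt-left : ∀ {B σ} → 0ℚ ≤ σ → ∀ m x → CappedAt B σ (suc m) x → CappedAt B σ m (leftChild m x)
cappedAt-left {B} {σ} σ≥0 m (s , b , d) cap =
  capped-left σ≥0 (tower≥2 m) (invTower-positive m) (invTower-inverse m)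
              (subst (λ T → Capped B σ T s b d) (tower-square m) cap)

node-balanced : ∀ L u → length u ℕ.≤ L → BalancedAt (budgetB L) (L ∸ length u) (nodeData L u)
node-balanced L u |u|≤L =
  walk-invariant (BalancedAt B) (balancedAt-right B) (balancedAt-left B) L _ u |u|≤L root
  where
  B = budgetB L
  root : BalancedAt B L (tower L , B , 0ℚ)
  root = subst (λ B → Balanced B (tower L) (tower L) B 0ℚ) (sym (tower-square L))
               (root-balanced (tower-positive L))

distance-monotone : ∀ B ℓ x p → length p ℕ.≤ ℓ → BalancedAt B ℓ x →
                    distance x ≤ distance (walk ℓ x p)
distance-monotone B ℓ x p |p|≤ℓ bal =
  proj₂ (walk-invariant Below right left ℓ x p |p|≤ℓ (bal , ≤-refl))
  where
  Below : ℕ → ℚ × ℚ × ℚ → Set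
  Below ℓ y = BalancedAt B ℓ y × distance x ≤ distance y
  right : ∀ m y → Below (suc m) y → Below m (rightChild m y)
  right m y@(_ , _ , d) (bal , x≤y) =
    balancedAt-right B m y bal , ≤-trans x≤y (≤-reflexive (sym (+-identityʳ d)))
  left : ∀ m y → Below (suc m) y → Below m (leftChild m y)
  left m y@(s , b , d) (bal , x≤y) =
    balancedAt-left B m y bal ,
    ≤-trans x≤y (≤-by (b - s) (0≤-difference (size≤budget bal (tower≥2 (suc m)))) refl)

-- Every node in the left subtree of a node of size s is farther than B - 2 s
-- from the root: already its left child is, as the slack is below s.
left-subtree-far : ∀ B k x w → suc (length w) ℕ.≤ k → BalancedAt B k x →
                   B - two * proj₁ x < distance (walk k x (false ∷ w))
left-subtree-far B (suc m) x@(s , b , d) w (s≤s |w|≤m) bal = begin-strict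
  B - two * s                          <⟨ <-by (s - (B - (d + b)))
                                               (0<-difference (slack<size bal (tower≥4 m)))
                                               (solve (B ∷ d ∷ b ∷ s ∷ []) ℚ-ring) ⟩
  d + (b - s)                          ≤⟨ distance-monotone B m (leftChild m x) w |w|≤m
                                            (balancedAt-left B m x bal) ⟩
  distance (walk m (leftChild m x) w)  ∎
  where open ≤-Reasoning

-- Every node in the right subtree of a node of size s, at level at least 2,
-- is within B - 4 s of the root: the right child is capped by s.
right-subtree-near : ∀ B k x w → 2 ℕ.+ length w ℕ.≤ k → BalancedAt B k x →
                     distance (walk k x (true ∷ w)) ≤ B - four * proj₁ x
right-subtree-near B (suc (suc n)) x@(s , b , d) w (s≤s (s≤s |w|≤n)) bal =
  Capped.distance-far
    (walk-invariant (CappedAt B s) (cappedAt-right s≥0) (cappedAt-left s≥0)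
                    (suc n) (rightChild (suc n) x) w (ℕ.m≤n⇒m≤1+n |w|≤n) right-child)
  where
  s≥0 : 0ℚ ≤ s
  s≥0 = <⇒≤ (Balanced.size-positive bal)
  right-child : CappedAt B s (suc n) (rightChild (suc n) x)
  right-child = capped-right-child (subst (five ≤_) (tower-square (suc n)) (tower≥5 n))
                                   (subst (λ T → Balanced B T s b d) (tower-square (suc n)) bal)

lemma3 : (L : ℕ) → 2 ℕ.≤ L → (u : List Bool) → 2 ℕ.+ length u ℕ.≤ L →
    (∀ (w : List Bool) → 2 ℕ.+ (length u ℕ.+ length w) ℕ.≤ L →
      budgetB L - (+ 2 / 1) * size L u < dist L (u ++ (false ∷ w)))
    × (∀ (w : List Bool) → 2 ℕ.+ (length u ℕ.+ length w) ℕ.≤ L →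
      dist L (u ++ (true ∷ w)) ≤ budgetB L - (+ 4 / 1) * size L u)
lemma3 L _ u 2+|u|≤L = left , right
  where
  B = budgetB L
  k = L ∸ length u

  u-balanced : BalancedAt B k (nodeData L u)
  u-balanced = node-balanced L u (ℕ.m+n≤o⇒n≤o 2 2+|u|≤L)

  fits : ∀ w → 2 ℕ.+ (length u ℕ.+ length w) ℕ.≤ L → 2 ℕ.+ length w ℕ.≤ k
  fits w h = ℕ.m+n≤o⇒m≤o∸n (2 ℕ.+ length w)
               (subst (ℕ._≤ L) (cong (2 ℕ.+_) (ℕ.+-comm (length u) (length w))) h)

  dist-below : ∀ c w → dist L (u ++ c ∷ w) ≡ distance (walk k (nodeData L u) (c ∷ w))
  dist-below c w = cong distance (walk-++ L _ u (c ∷ w))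

  left : ∀ w → 2 ℕ.+ (length u ℕ.+ length w) ℕ.≤ L → B - two * size L u < dist L (u ++ false ∷ w)
  left w h = subst (B - two * size L u <_) (sym (dist-below false w))
               (left-subtree-far B k (nodeData L u) w (ℕ.<⇒≤ (fits w h)) u-balanced)

  right : ∀ w → 2 ℕ.+ (length u ℕ.+ length w) ℕ.≤ L → dist L (u ++ true ∷ w) ≤ B - four * size L u
  right w h = subst (_≤ B - four * size L u) (sym (dist-below true w))
                (right-subtree-near B k (nodeData L u) w (fits w h) u-balanced)
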